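{- Fix $d$ and $i\le d$. There exists a number $q(i,d)$ such that if $\Delta$ is a pure $(d-1)$-dimensional simplicial complex and the link of every $(i-2)$-dimensional face of $\Delta$ has at least $q(i,d)$ vertices, then $h_0<h_1<\dots<h_i$.
   Context: $h_i=\sum_{j=0}^i(-1)^{i-j}\binom{d-j}{d-i}f_j$, where $f_j$ is the number of faces of $\Delta$ with $j$ vertices. The empty face has dimension $-1$, and its link is $\Delta$. -}

module Defs where

open import Data.Bool using (Bool; true; false; _∧_; not)
open import Data.Nat using (ℕ; zero; suc; _∸_; _≡ᵇ_; _≤_; _<_)
open import Data.Nat.Combinatorics using (_C_)
open import Data.Integer as ℤ using (ℤ; +_; -_)
open import Data.Fin using (Fin)
open import Data.Fin.Subset using (Subset; _⊆_; ⁅_⁆; _∪_; ∣_∣; outside; inside)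
import Data.Fin.Subset as Sub
open import Data.Vec using (Vec; []; _∷_; lookup)
open import Data.List using (List; []; _∷_; map; _++_; upTo; allFin)
open import Data.Product using (Σ; _×_)
open import Relation.Binary.PropositionalEquality using (_≡_)

allSubsets : (n : ℕ) → List (Subset n)
allSubsets zero    = [] ∷ []
allSubsets (suc n) = map (outside ∷_) (allSubsets n) ++ map (inside ∷_) (allSubsets n)

countB : {A : Set} → (A → Bool) → List A → ℕ
countB p []       = 0
countB p (x ∷ xs) with p x
... | true  = suc (countB p xs)
... | false = countB p xs

record SimplicialComplex (n : ℕ) : Set where
  field
    isFace    : Subset n → Bool
    emptyFace : isFace Sub.⊥ ≡ true
    downClosed : ∀ (S T : Subset n) → T ⊆ S → isFace S ≡ true → isFace T ≡ true
open SimplicialComplex public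

-- Δ is pure of dimension (d-1): every face lies in a face with exactly d vertices
-- (hence all facets have exactly d vertices).
IsPure : {n : ℕ} → SimplicialComplex n → ℕ → Set
IsPure {n} Δ d = ∀ (S : Subset n) → isFace Δ S ≡ true →
  Σ (Subset n) (λ T → S ⊆ T × isFace Δ T ≡ true × ∣ T ∣ ≡ d)

fvec : {n : ℕ} → SimplicialComplex n → ℕ → ℕ
fvec {n} Δ j = countB (λ S → isFace Δ S ∧ (∣ S ∣ ≡ᵇ j)) (allSubsets n)

linkVertexCount : {n : ℕ} → SimplicialComplex n → Subset n → ℕ
linkVertexCount {n} Δ F = countB (λ v → not (lookup F v) ∧ isFace Δ (F ∪ ⁅ v ⁆)) (allFin n)

sign : ℕ → ℤ
sign zero          = + 1
sign (suc zero)    = - (+ 1)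
sign (suc (suc k)) = sign k

sumℤ : List ℤ → ℤ
sumℤ []       = + 0
sumℤ (x ∷ xs) = x ℤ.+ sumℤ xs

hvec : {n : ℕ} → SimplicialComplex n → ℕ → ℕ → ℤ
hvec Δ d i = sumℤ (map (λ j → sign (i ∸ j) ℤ.* (+ ((d ∸ j) C (d ∸ i)) ℤ.* + fvec Δ j)) (upTo (suc i)))

-- Double counting the pairs (face with k vertices, vertex of its link) gives q f_k ≤ (k + 1) f_{k+1}
-- whenever every face with k vertices has at least q link vertices. By purity, and since links shrink
-- as faces grow, the hypothesis on faces with i - 1 vertices yields this for every k < i. Taking
-- W = (d + 1) 2^d and q = (d + 1)(2W + 1), the f-vector grows by a factor 2W + 1 up to f_i. Binomial
-- coefficients are at most 2^d and f is increasing, so h_k and h_{k+1} - f_{k+1} both have absolute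
-- value at most W f_k, whence h_k ≤ W f_k < f_{k+1} - W f_k ≤ h_{k+1}.
module Submission where

open import Defs
open import Data.Bool using (Bool; true; false; _∧_; not; if_then_else_)
open import Data.Bool.Properties using (∧-identityʳ; ∧-zeroʳ; T-≡)
open import Data.Nat using (ℕ; zero; suc; _+_; _*_; _∸_; _^_; _≤_; _<_; z≤n; s≤s; _≡ᵇ_; _≤?_)
open import Data.Nat.Properties
open import Data.Nat.Combinatorics using (_C_; nCn≡1; nCk+nC[k+1]≡[n+1]C[k+1])
open import Data.Integer as ℤ using (ℤ; +_; -_; -[1+_]; +≤+; +<+; -≤+) renaming (∣_∣ to ∣_∣ᶻ)
import Data.Integer.Properties as ℤ
open import Algebra.Properties.CommutativeSemigroup +-commutativeSemigroup using (interchange; xy∙z≈y∙xz)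
open import Algebra.Properties.CommutativeMonoid.Sum +-0-commutativeMonoid using (sum-syntax; sum-cong-≗)
open import Data.Fin using (Fin; zero; suc)
open import Data.Fin.Subset using (Subset; _⊆_; ⁅_⁆; _∪_; ∣_∣; outside; inside)
import Data.Fin.Subset as Subset
open import Data.Fin.Subset.Properties
  using (∪-identityʳ; x∈p∪q⁻; x∈p∪q⁺; drop-∷-⊆; out⊆; in⊆in; ⊆-refl)
open import Data.Vec using ([]; _∷_; lookup; here)
open import Data.Vec.Properties using ([]=⇒lookup; lookup⇒[]=)
open import Data.Product using (Σ; ∃-syntax; _×_; _,_)
open import Data.Sum using (inj₁; inj₂)
open import Function.Bundles using (Equivalence)
open import Data.List using (List; []; _∷_; map; _++_; tabulate; allFin; applyUpTo; _∷ʳ_)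
open import Data.List.Properties using (map-upTo; applyUpTo-∷ʳ)
open import Function using (_∘_; id)
open import Relation.Nullary using (yes; no; contradiction)
open import Relation.Binary.PropositionalEquality

indicator : Bool → ℕ
indicator true  = 1
indicator false = 0

sumSubsets : ∀ {n} → (Subset n → ℕ) → ℕ
sumSubsets {zero}  f = f []
sumSubsets {suc n} f = sumSubsets (f ∘ (outside ∷_)) + sumSubsets (f ∘ (inside ∷_))

countB-++ : ∀ {A : Set} (p : A → Bool) xs ys → countB p (xs ++ ys) ≡ countB p xs + countB p ys
countB-++ p []       ys = refl
countB-++ p (x ∷ xs) ys with p x
... | true  = cong suc (countB-++ p xs ys)
... | false = countB-++ p xs ys

countB-map : ∀ {A B : Set} (p : B → Bool) (f : A → B) xs → countB p (map f xs) ≡ countB (p ∘ f) xs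
countB-map p f []       = refl
countB-map p f (x ∷ xs) with p (f x)
... | true  = cong suc (countB-map p f xs)
... | false = countB-map p f xs

countB-tabulate : ∀ {A : Set} {n} (p : A → Bool) (f : Fin n → A) →
  countB p (tabulate f) ≡ ∑[ v < n ] indicator (p (f v))
countB-tabulate {n = zero}  p f = refl
countB-tabulate {n = suc n} p f with p (f zero)
... | true  = cong suc (countB-tabulate p (f ∘ suc))
... | false = countB-tabulate p (f ∘ suc)

countB-allSubsets : ∀ {n} (p : Subset n → Bool) → countB p (allSubsets n) ≡ sumSubsets (indicator ∘ p)
countB-allSubsets {zero}  p with p []
... | true  = refl
... | false = refl
countB-allSubsets {suc n} p = begin
  countB p (map (outside ∷_) (allSubsets n) ++ map (inside ∷_) (allSubsets n))
    ≡⟨ countB-++ p (map (outside ∷_) (allSubsets n)) (map (inside ∷_) (allSubsets n)) ⟩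
  countB p (map (outside ∷_) (allSubsets n)) + countB p (map (inside ∷_) (allSubsets n))
    ≡⟨ cong₂ _+_ (countB-map p (outside ∷_) (allSubsets n)) (countB-map p (inside ∷_) (allSubsets n)) ⟩
  countB (p ∘ (outside ∷_)) (allSubsets n) + countB (p ∘ (inside ∷_)) (allSubsets n)
    ≡⟨ cong₂ _+_ (countB-allSubsets (p ∘ (outside ∷_))) (countB-allSubsets (p ∘ (inside ∷_))) ⟩
  sumSubsets (indicator ∘ p) ∎
  where open ≡-Reasoning

countB-mono : ∀ {A : Set} {p p′ : A → Bool} → (∀ x → p x ≡ true → p′ x ≡ true) →
  ∀ xs → countB p xs ≤ countB p′ xs
countB-mono         p⇒p′ []       = z≤n
countB-mono {p = p} {p′} p⇒p′ (x ∷ xs) with p x in px | p′ x in p′x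
... | true  | true  = s≤s (countB-mono p⇒p′ xs)
... | true  | false = contradiction (trans (sym (p⇒p′ x px)) p′x) λ ()
... | false | true  = m≤n⇒m≤1+n (countB-mono p⇒p′ xs)
... | false | false = countB-mono p⇒p′ xs

sumSubsets-cong : ∀ {n} {f g : Subset n → ℕ} → (∀ S → f S ≡ g S) → sumSubsets f ≡ sumSubsets g
sumSubsets-cong {zero}  f≗g = f≗g []
sumSubsets-cong {suc n} f≗g =
  cong₂ _+_ (sumSubsets-cong (f≗g ∘ (outside ∷_))) (sumSubsets-cong (f≗g ∘ (inside ∷_)))

sumSubsets-mono : ∀ {n} {f g : Subset n → ℕ} → (∀ S → f S ≤ g S) → sumSubsets f ≤ sumSubsets g
sumSubsets-mono {zero}  f≤g = f≤g []
sumSubsets-mono {suc n} f≤g =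
  +-mono-≤ (sumSubsets-mono (f≤g ∘ (outside ∷_))) (sumSubsets-mono (f≤g ∘ (inside ∷_)))

sumSubsets-distrib-+ : ∀ {n} (f g : Subset n → ℕ) →
  sumSubsets (λ S → f S + g S) ≡ sumSubsets f + sumSubsets g
sumSubsets-distrib-+ {zero}  f g = refl
sumSubsets-distrib-+ {suc n} f g = trans
  (cong₂ _+_ (sumSubsets-distrib-+ (f ∘ (outside ∷_)) (g ∘ (outside ∷_)))
             (sumSubsets-distrib-+ (f ∘ (inside ∷_)) (g ∘ (inside ∷_))))
  (interchange (sumSubsets (f ∘ (outside ∷_))) _ (sumSubsets (f ∘ (inside ∷_))) _)

*-distribˡ-sumSubsets : ∀ {n} c (f : Subset n → ℕ) → c * sumSubsets f ≡ sumSubsets (λ S → c * f S)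
*-distribˡ-sumSubsets {zero}  c f = refl
*-distribˡ-sumSubsets {suc n} c f = trans (*-distribˡ-+ c _ _)
  (cong₂ _+_ (*-distribˡ-sumSubsets c (f ∘ (outside ∷_))) (*-distribˡ-sumSubsets c (f ∘ (inside ∷_))))

sumSubsets-zero : ∀ {n} → sumSubsets {n} (λ _ → 0) ≡ 0
sumSubsets-zero {zero}  = refl
sumSubsets-zero {suc n} = cong₂ _+_ (sumSubsets-zero {n}) (sumSubsets-zero {n})

sumSubsets-emptyOnly : ∀ {n} (p : Subset n → Bool) →
  sumSubsets (λ S → indicator (p S ∧ (∣ S ∣ ≡ᵇ 0))) ≡ indicator (p Subset.⊥)
sumSubsets-emptyOnly {zero}  p = cong indicator (∧-identityʳ (p []))
sumSubsets-emptyOnly {suc n} p = begin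
  sumSubsets (λ S → indicator (p (outside ∷ S) ∧ (∣ S ∣ ≡ᵇ 0)))
    + sumSubsets (λ S → indicator (p (inside ∷ S) ∧ false))
      ≡⟨ cong₂ _+_ (sumSubsets-emptyOnly (p ∘ (outside ∷_)))
                   (sumSubsets-cong (cong indicator ∘ ∧-zeroʳ ∘ p ∘ (inside ∷_))) ⟩
  indicator (p Subset.⊥) + sumSubsets {n} (λ _ → 0)
      ≡⟨ cong (_+_ (indicator (p Subset.⊥))) (sumSubsets-zero {n}) ⟩
  indicator (p Subset.⊥) + 0
      ≡⟨ +-identityʳ _ ⟩
  indicator (p Subset.⊥) ∎
  where open ≡-Reasoning

-- Each pair (S, v) with v ∉ S is counted once at G = S ∪ ⁅ v ⁆, and each G arises from ∣ G ∣ pairs.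
sumSubsets-extensions : ∀ {n} (P : Subset n → ℕ) →
  sumSubsets (λ S → ∑[ v < n ] (if lookup S v then 0 else P (S ∪ ⁅ v ⁆)))
    ≡ sumSubsets (λ G → ∣ G ∣ * P G)
sumSubsets-extensions {zero}  P = refl
sumSubsets-extensions {suc n} P = begin
  sumSubsets (λ S → P (inside ∷ (S ∪ Subset.⊥)) + extensions outside S)
    + sumSubsets (extensions inside)
    ≡⟨ cong (_+ sumSubsets (extensions inside)) (sumSubsets-distrib-+ _ (extensions outside)) ⟩
  (sumSubsets (λ S → P (inside ∷ (S ∪ Subset.⊥))) + sumSubsets (extensions outside))
    + sumSubsets (extensions inside)
    ≡⟨ cong₂ _+_ (cong₂ _+_ (sumSubsets-cong (cong (P ∘ (inside ∷_)) ∘ ∪-identityʳ))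
                            (sumSubsets-extensions (P ∘ (outside ∷_))))
                 (sumSubsets-extensions (P ∘ (inside ∷_))) ⟩
  (sumSubsets (P ∘ (inside ∷_)) + weighted outside) + weighted inside
    ≡⟨ xy∙z≈y∙xz (sumSubsets (P ∘ (inside ∷_))) (weighted outside) (weighted inside) ⟩
  weighted outside + (sumSubsets (P ∘ (inside ∷_)) + weighted inside)
    ≡⟨ cong (_+_ (weighted outside))
            (sumSubsets-distrib-+ (P ∘ (inside ∷_)) (λ G → ∣ G ∣ * P (inside ∷ G))) ⟨
  sumSubsets (λ G → ∣ G ∣ * P G) ∎
  where
  open ≡-Reasoning
  extensions : Bool → Subset n → ℕ
  extensions b S = ∑[ v < n ] (if lookup S v then 0 else P (b ∷ (S ∪ ⁅ v ⁆)))
  weighted : Bool → ℕ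
  weighted b = sumSubsets (λ G → ∣ G ∣ * P (b ∷ G))

≡ᵇ≡true⇒≡ : ∀ m n → (m ≡ᵇ n) ≡ true → m ≡ n
≡ᵇ≡true⇒≡ m n eq = ≡ᵇ⇒≡ m n (Equivalence.from T-≡ eq)

≡⇒≡ᵇ≡true : ∀ {m n} → m ≡ n → (m ≡ᵇ n) ≡ true
≡⇒≡ᵇ≡true {m} {n} eq = Equivalence.to T-≡ (≡⇒≡ᵇ m n eq)

∣p∪⁅x⁆∣≡1+∣p∣ : ∀ {n} (p : Subset n) x → lookup p x ≡ false →
  ∣ p ∪ ⁅ x ⁆ ∣ ≡ suc ∣ p ∣
∣p∪⁅x⁆∣≡1+∣p∣ (outside ∷ p) zero    _   = cong (suc ∘ ∣_∣) (∪-identityʳ p)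
∣p∪⁅x⁆∣≡1+∣p∣ (inside  ∷ p) zero    ()
∣p∪⁅x⁆∣≡1+∣p∣ (outside ∷ p) (suc x) x∉p = ∣p∪⁅x⁆∣≡1+∣p∣ p x x∉p
∣p∪⁅x⁆∣≡1+∣p∣ (inside  ∷ p) (suc x) x∉p = cong suc (∣p∪⁅x⁆∣≡1+∣p∣ p x x∉p)

∪-monoˡ-⊆ : ∀ {n} {p q : Subset n} r → p ⊆ q → p ∪ r ⊆ q ∪ r
∪-monoˡ-⊆ {p = p} {q} r p⊆q x∈p∪r with x∈p∪q⁻ p r x∈p∪r
... | inj₁ x∈p = x∈p∪q⁺ (inj₁ (p⊆q x∈p))
... | inj₂ x∈r = x∈p∪q⁺ {p = q} (inj₂ x∈r)

⊆-interpolate : ∀ {n} {p r : Subset n} m → p ⊆ r → ∣ p ∣ ≤ m → m ≤ ∣ r ∣ →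
  ∃[ q ] p ⊆ q × q ⊆ r × ∣ q ∣ ≡ m
⊆-interpolate {p = []}          {[]}          zero    _   _   _  = [] , ⊆-refl , ⊆-refl , refl
⊆-interpolate {p = inside  ∷ p} {outside ∷ r} m       p⊆r _   _  = contradiction (p⊆r here) λ ()
⊆-interpolate {p = inside  ∷ p} {inside  ∷ r} (suc m) p⊆r (s≤s p≤m) (s≤s m≤r)
  with q , p⊆q , q⊆r , ∣q∣≡m ← ⊆-interpolate m (drop-∷-⊆ p⊆r) p≤m m≤r
  = inside ∷ q , in⊆in p⊆q , in⊆in q⊆r , cong suc ∣q∣≡m
⊆-interpolate {p = outside ∷ p} {outside ∷ r} m       p⊆r p≤m m≤r
  with q , p⊆q , q⊆r , ∣q∣≡m ← ⊆-interpolate m (drop-∷-⊆ p⊆r) p≤m m≤r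
  = outside ∷ q , out⊆ p⊆q , out⊆ q⊆r , ∣q∣≡m
⊆-interpolate {p = outside ∷ p} {inside  ∷ r} m       p⊆r p≤m m≤1+r with m ≤? ∣ r ∣
... | no m≰r = inside ∷ r , p⊆r , ⊆-refl , ≤-antisym (≰⇒> m≰r) m≤1+r
... | yes m≤r with q , p⊆q , q⊆r , ∣q∣≡m ← ⊆-interpolate m (drop-∷-⊆ p⊆r) p≤m m≤r
  = outside ∷ q , out⊆ p⊆q , out⊆ q⊆r , ∣q∣≡m

module _ {n} (Δ : SimplicialComplex n) where

  linkVertexCount-antitone : ∀ {F G} → F ⊆ G → linkVertexCount Δ G ≤ linkVertexCount Δ F
  linkVertexCount-antitone {F} {G} F⊆G = countB-mono linkOfG⇒linkOfF (allFin n)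
    where
    linkOfG⇒linkOfF : ∀ v → (not (lookup G v) ∧ isFace Δ (G ∪ ⁅ v ⁆)) ≡ true →
                             (not (lookup F v) ∧ isFace Δ (F ∪ ⁅ v ⁆)) ≡ true
    linkOfG⇒linkOfF v G+v∈Δ with lookup G v in v∈?G | lookup F v in v∈?F
    ... | true  | _     = contradiction G+v∈Δ λ ()
    ... | false | true  = contradiction (trans (sym v∈G) v∈?G) λ ()
      where
      v∈G : lookup G v ≡ true
      v∈G = []=⇒lookup (F⊆G (lookup⇒[]= v F v∈?F))
    ... | false | false = downClosed Δ (G ∪ ⁅ v ⁆) (F ∪ ⁅ v ⁆) (∪-monoˡ-⊆ ⁅ v ⁆ F⊆G) G+v∈Δ

  -- Inside a facet, G extends to a face with i - 1 vertices, and links shrink as faces grow.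
  largeLinks-downward : ∀ {d i q} → i ≤ d → IsPure Δ d →
    (∀ F → isFace Δ F ≡ true → ∣ F ∣ + 1 ≡ i → q ≤ linkVertexCount Δ F) →
    ∀ G → isFace Δ G ≡ true → ∣ G ∣ < i → q ≤ linkVertexCount Δ G
  largeLinks-downward {i = suc i} i≤d pure links G G∈Δ (s≤s ∣G∣≤i)
    with T , G⊆T , T∈Δ , ∣T∣≡d ← pure G G∈Δ
    with F , G⊆F , F⊆T , ∣F∣≡i ←
           ⊆-interpolate i G⊆T ∣G∣≤i (subst (i ≤_) (sym ∣T∣≡d) (<⇒≤ i≤d))
    = ≤-trans (links F (downClosed Δ T F F⊆T T∈Δ) (trans (+-comm ∣ F ∣ 1) (cong suc ∣F∣≡i)))
              (linkVertexCount-antitone G⊆F)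

  faceIndicator : ℕ → Subset n → ℕ
  faceIndicator k S = indicator (isFace Δ S ∧ (∣ S ∣ ≡ᵇ k))

  fvec≡sumSubsets : ∀ k → fvec Δ k ≡ sumSubsets (faceIndicator k)
  fvec≡sumSubsets k = countB-allSubsets (λ S → isFace Δ S ∧ (∣ S ∣ ≡ᵇ k))

  fvec-zero : fvec Δ 0 ≡ 1
  fvec-zero = begin
    fvec Δ 0                       ≡⟨ fvec≡sumSubsets 0 ⟩
    sumSubsets (faceIndicator 0)   ≡⟨ sumSubsets-emptyOnly (isFace Δ) ⟩
    indicator (isFace Δ Subset.⊥)  ≡⟨ cong indicator (emptyFace Δ) ⟩
    1                              ∎
    where open ≡-Reasoning

  ∣∣*faceIndicator : ∀ k G → ∣ G ∣ * faceIndicator k G ≡ k * faceIndicator k G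
  ∣∣*faceIndicator k G with isFace Δ G | ∣ G ∣ ≡ᵇ k in ∣G∣≡k
  ... | false | _     = trans (*-zeroʳ ∣ G ∣) (sym (*-zeroʳ k))
  ... | true  | false = trans (*-zeroʳ ∣ G ∣) (sym (*-zeroʳ k))
  ... | true  | true  = cong (_* 1) (≡ᵇ≡true⇒≡ ∣ G ∣ k ∣G∣≡k)

  linkVertexCount≡extensions : ∀ {k} S → ∣ S ∣ ≡ k →
    linkVertexCount Δ S ≡ ∑[ v < n ] (if lookup S v then 0 else faceIndicator (suc k) (S ∪ ⁅ v ⁆))
  linkVertexCount≡extensions {k} S ∣S∣≡k =
    trans (countB-tabulate (λ v → not (lookup S v) ∧ isFace Δ (S ∪ ⁅ v ⁆)) id) (sum-cong-≗ extension)
    where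
    extension : ∀ v → indicator (not (lookup S v) ∧ isFace Δ (S ∪ ⁅ v ⁆))
                    ≡ (if lookup S v then 0 else faceIndicator (suc k) (S ∪ ⁅ v ⁆))
    extension v with lookup S v in v∈?S
    ... | true  = refl
    ... | false = cong indicator (sym (trans
      (cong (isFace Δ (S ∪ ⁅ v ⁆) ∧_) (≡⇒≡ᵇ≡true ∣S∪v∣≡1+k))
      (∧-identityʳ (isFace Δ (S ∪ ⁅ v ⁆)))))
      where
      ∣S∪v∣≡1+k : ∣ S ∪ ⁅ v ⁆ ∣ ≡ suc k
      ∣S∪v∣≡1+k = trans (∣p∪⁅x⁆∣≡1+∣p∣ S v v∈?S) (cong suc ∣S∣≡k)

  fvec-growth : ∀ {q} k → (∀ S → isFace Δ S ≡ true → ∣ S ∣ ≡ k → q ≤ linkVertexCount Δ S) →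
    q * fvec Δ k ≤ suc k * fvec Δ (suc k)
  fvec-growth {q} k links = begin
    q * fvec Δ k                                     ≡⟨ cong (q *_) (fvec≡sumSubsets k) ⟩
    q * sumSubsets (faceIndicator k)                 ≡⟨ *-distribˡ-sumSubsets q (faceIndicator k) ⟩
    sumSubsets (λ S → q * faceIndicator k S)         ≤⟨ sumSubsets-mono faceBound ⟩
    sumSubsets (λ S → ∑[ v < n ] (if lookup S v then 0 else faceIndicator (suc k) (S ∪ ⁅ v ⁆)))
                                                     ≡⟨ sumSubsets-extensions (faceIndicator (suc k)) ⟩
    sumSubsets (λ G → ∣ G ∣ * faceIndicator (suc k) G) ≡⟨ sumSubsets-cong (∣∣*faceIndicator (suc k)) ⟩
    sumSubsets (λ G → suc k * faceIndicator (suc k) G) ≡⟨ *-distribˡ-sumSubsets (suc k) (faceIndicator (suc k)) ⟨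
    suc k * sumSubsets (faceIndicator (suc k))       ≡⟨ cong (suc k *_) (fvec≡sumSubsets (suc k)) ⟨
    suc k * fvec Δ (suc k)                           ∎
    where
    open ≤-Reasoning
    faceBound : ∀ S → q * faceIndicator k S
                    ≤ ∑[ v < n ] (if lookup S v then 0 else faceIndicator (suc k) (S ∪ ⁅ v ⁆))
    faceBound S with isFace Δ S in S∈Δ | ∣ S ∣ ≡ᵇ k in ∣S∣≡k
    ... | false | _     = ≤-trans (≤-reflexive (*-zeroʳ q)) z≤n
    ... | true  | false = ≤-trans (≤-reflexive (*-zeroʳ q)) z≤n
    ... | true  | true  = begin
      q * 1                ≡⟨ *-identityʳ q ⟩
      q                    ≤⟨ links S S∈Δ (≡ᵇ≡true⇒≡ ∣ S ∣ k ∣S∣≡k) ⟩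
      linkVertexCount Δ S  ≡⟨ linkVertexCount≡extensions S (≡ᵇ≡true⇒≡ ∣ S ∣ k ∣S∣≡k) ⟩
      _                    ∎

  fvec-growthRate : ∀ {d i g} → i ≤ d → IsPure Δ d →
    (∀ F → isFace Δ F ≡ true → ∣ F ∣ + 1 ≡ i → suc d * g ≤ linkVertexCount Δ F) →
    ∀ k → k < i → g * fvec Δ k ≤ fvec Δ (suc k)
  fvec-growthRate {d} {i} {g} i≤d pure links k k<i = *-cancelˡ-≤ (suc k) (begin
    suc k * (g * fvec Δ k)  ≤⟨ *-monoˡ-≤ (g * fvec Δ k) (s≤s (≤-trans (<⇒≤ k<i) i≤d)) ⟩
    suc d * (g * fvec Δ k)  ≡⟨ *-assoc (suc d) g (fvec Δ k) ⟨
    suc d * g * fvec Δ k    ≤⟨ fvec-growth k largeLinks ⟩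
    suc k * fvec Δ (suc k)  ∎)
    where
    open ≤-Reasoning
    largeLinks : ∀ S → isFace Δ S ≡ true → ∣ S ∣ ≡ k → suc d * g ≤ linkVertexCount Δ S
    largeLinks S S∈Δ refl = largeLinks-downward i≤d pure links S S∈Δ k<i

monotone-upTo : ∀ (f : ℕ → ℕ) {i} → (∀ k → k < i → f k ≤ f (suc k)) →
  ∀ {j k} → j ≤ k → k ≤ i → f j ≤ f k
monotone-upTo f step {k = zero}  z≤n  _    = ≤-refl
monotone-upTo f step {k = suc k} j≤1+k 1+k≤i with m≤n⇒m<n∨m≡n j≤1+k
... | inj₂ refl      = ≤-refl
... | inj₁ (s≤s j≤k) = ≤-trans (monotone-upTo f step j≤k (<⇒≤ 1+k≤i)) (step k 1+k≤i)

∣sign∣≡1 : ∀ s → ∣ sign s ∣ᶻ ≡ 1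
∣sign∣≡1 zero          = refl
∣sign∣≡1 (suc zero)    = refl
∣sign∣≡1 (suc (suc s)) = ∣sign∣≡1 s

∣sign*+c*+f∣≡c*f : ∀ s c f → ∣ sign s ℤ.* (+ c ℤ.* + f) ∣ᶻ ≡ c * f
∣sign*+c*+f∣≡c*f s c f = begin
  ∣ sign s ℤ.* (+ c ℤ.* + f) ∣ᶻ      ≡⟨ ℤ.abs-* (sign s) (+ c ℤ.* + f) ⟩
  ∣ sign s ∣ᶻ * ∣ + c ℤ.* + f ∣ᶻ     ≡⟨ cong (_* ∣ + c ℤ.* + f ∣ᶻ) (∣sign∣≡1 s) ⟩
  1 * ∣ + c ℤ.* + f ∣ᶻ               ≡⟨ *-identityˡ _ ⟩
  ∣ + c ℤ.* + f ∣ᶻ                   ≡⟨ ℤ.abs-* (+ c) (+ f) ⟩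
  c * f                              ∎
  where open ≡-Reasoning

nCk≤2^n : ∀ n k → n C k ≤ 2 ^ n
nCk≤2^n zero    zero    = ≤-refl
nCk≤2^n zero    (suc k) = z≤n
nCk≤2^n (suc n) zero    = m^n>0 2 (suc n)
nCk≤2^n (suc n) (suc k) = begin
  suc n C suc k      ≡⟨ nCk+nC[k+1]≡[n+1]C[k+1] n k ⟨
  n C k + n C suc k  ≤⟨ +-mono-≤ (nCk≤2^n n k) (nCk≤2^n n (suc k)) ⟩
  2 ^ n + 2 ^ n      ≡⟨ cong (_+_ (2 ^ n)) (+-identityʳ (2 ^ n)) ⟨
  2 ^ suc n          ∎
  where open ≤-Reasoning

sumℤ-++ : ∀ xs ys → sumℤ (xs ++ ys) ≡ sumℤ xs ℤ.+ sumℤ ys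
sumℤ-++ []       ys = sym (ℤ.+-identityˡ (sumℤ ys))
sumℤ-++ (x ∷ xs) ys = trans (cong (ℤ._+_ x) (sumℤ-++ xs ys)) (sym (ℤ.+-assoc x (sumℤ xs) (sumℤ ys)))

sumℤ-applyUpTo-suc : ∀ (t : ℕ → ℤ) m → sumℤ (applyUpTo t (suc m)) ≡ sumℤ (applyUpTo t m) ℤ.+ t m
sumℤ-applyUpTo-suc t m = begin
  sumℤ (applyUpTo t (suc m))              ≡⟨ cong sumℤ (applyUpTo-∷ʳ t m) ⟨
  sumℤ (applyUpTo t m ∷ʳ t m)             ≡⟨ sumℤ-++ (applyUpTo t m) (t m ∷ []) ⟩
  sumℤ (applyUpTo t m) ℤ.+ (t m ℤ.+ + 0)  ≡⟨ cong (ℤ._+_ (sumℤ (applyUpTo t m))) (ℤ.+-identityʳ (t m)) ⟩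
  sumℤ (applyUpTo t m) ℤ.+ t m            ∎
  where open ≡-Reasoning

∣sumℤ-applyUpTo∣≤ : ∀ m (t : ℕ → ℤ) {B} → (∀ j → j < m → ∣ t j ∣ᶻ ≤ B) →
  ∣ sumℤ (applyUpTo t m) ∣ᶻ ≤ m * B
∣sumℤ-applyUpTo∣≤ zero    t t≤B = z≤n
∣sumℤ-applyUpTo∣≤ (suc m) t t≤B = ≤-trans (ℤ.∣i+j∣≤∣i∣+∣j∣ (t 0) _)
  (+-mono-≤ (t≤B 0 (s≤s z≤n)) (∣sumℤ-applyUpTo∣≤ m (t ∘ suc) (λ j j<m → t≤B (suc j) (s≤s j<m))))

i≤+∣i∣ : ∀ i → i ℤ.≤ + ∣ i ∣ᶻ
i≤+∣i∣ (+ n)    = ℤ.≤-refl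
i≤+∣i∣ -[1+ n ] = -≤+

-+∣i∣≤i : ∀ i → - (+ ∣ i ∣ᶻ) ℤ.≤ i
-+∣i∣≤i (+ zero)  = ℤ.≤-refl
-+∣i∣≤i (+ suc n) = -≤+
-+∣i∣≤i -[1+ n ]  = ℤ.≤-refl

<-+-dominant : ∀ a r {X f} → ∣ a ∣ᶻ ≤ X → ∣ r ∣ᶻ ≤ X → X + X < f → a ℤ.< r ℤ.+ + f
<-+-dominant a r {X} {f} ∣a∣≤X ∣r∣≤X 2X<f = begin-strict
  a                  ≤⟨ ℤ.≤-trans (i≤+∣i∣ a) (+≤+ ∣a∣≤X) ⟩
  + X                <⟨ +<+ (m+n≤o⇒m≤o∸n (suc X) 2X<f) ⟩
  + (f ∸ X)          ≡⟨ ℤ.⊖-≥ (≤-trans (m≤m+n X X) (<⇒≤ 2X<f)) ⟨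
  f ℤ.⊖ X            ≡⟨ ℤ.-m+n≡n⊖m X f ⟨
  - (+ X) ℤ.+ + f    ≤⟨ ℤ.+-monoˡ-≤ (+ f) (ℤ.≤-trans (ℤ.neg-mono-≤ (+≤+ ∣r∣≤X)) (-+∣i∣≤i r)) ⟩
  r ℤ.+ + f          ∎
  where open ℤ.≤-Reasoning

w*m+w*m<n : ∀ w {m n} → 0 < m → suc (w + w) * m ≤ n → w * m + w * m < n
w*m+w*m<n w {m} {n} m>0 growth = begin-strict
  w * m + w * m      ≡⟨ *-distribʳ-+ m w w ⟨
  (w + w) * m        <⟨ m<n+m ((w + w) * m) m>0 ⟩
  suc (w + w) * m    ≤⟨ growth ⟩
  n                  ∎
  where open ≤-Reasoning

coefficientBound : ℕ → ℕ
coefficientBound d = suc d * 2 ^ d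

module _ {n} (Δ : SimplicialComplex n) (d : ℕ) where

  hTerm : ℕ → ℕ → ℤ
  hTerm i j = sign (i ∸ j) ℤ.* (+ ((d ∸ j) C (d ∸ i)) ℤ.* + fvec Δ j)

  hvec≡sumℤ-hTerm : ∀ i → hvec Δ d i ≡ sumℤ (applyUpTo (hTerm i) (suc i))
  hvec≡sumℤ-hTerm i = cong sumℤ (map-upTo (hTerm i) (suc i))

  hTerm-diagonal : ∀ i → hTerm i i ≡ + fvec Δ i
  hTerm-diagonal i rewrite n∸n≡0 i | nCn≡1 (d ∸ i) = trans (ℤ.*-identityˡ _) (ℤ.*-identityˡ _)

  hvec-suc : ∀ k → hvec Δ d (suc k) ≡ sumℤ (applyUpTo (hTerm (suc k)) (suc k)) ℤ.+ + fvec Δ (suc k)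
  hvec-suc k = begin
    hvec Δ d (suc k)                                ≡⟨ hvec≡sumℤ-hTerm (suc k) ⟩
    sumℤ (applyUpTo (hTerm (suc k)) (suc (suc k)))  ≡⟨ sumℤ-applyUpTo-suc (hTerm (suc k)) (suc k) ⟩
    sumℤ lower ℤ.+ hTerm (suc k) (suc k)            ≡⟨ cong (ℤ._+_ (sumℤ lower)) (hTerm-diagonal (suc k)) ⟩
    sumℤ lower ℤ.+ + fvec Δ (suc k)                 ∎
    where
    open ≡-Reasoning
    lower : List ℤ
    lower = applyUpTo (hTerm (suc k)) (suc k)

  ∣sumℤ-hTerm∣≤ : ∀ i {m F} → m ≤ suc d → (∀ j → j < m → fvec Δ j ≤ F) →
    ∣ sumℤ (applyUpTo (hTerm i) m) ∣ᶻ ≤ coefficientBound d * F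
  ∣sumℤ-hTerm∣≤ i {m} {F} m≤1+d f≤F = begin
    ∣ sumℤ (applyUpTo (hTerm i) m) ∣ᶻ  ≤⟨ ∣sumℤ-applyUpTo∣≤ m (hTerm i) termBound ⟩
    m * (2 ^ d * F)                    ≤⟨ *-monoˡ-≤ (2 ^ d * F) m≤1+d ⟩
    suc d * (2 ^ d * F)                ≡⟨ *-assoc (suc d) (2 ^ d) F ⟨
    coefficientBound d * F             ∎
    where
    open ≤-Reasoning
    termBound : ∀ j → j < m → ∣ hTerm i j ∣ᶻ ≤ 2 ^ d * F
    termBound j j<m = begin
      ∣ hTerm i j ∣ᶻ                  ≡⟨ ∣sign*+c*+f∣≡c*f (i ∸ j) ((d ∸ j) C (d ∸ i)) (fvec Δ j) ⟩
      ((d ∸ j) C (d ∸ i)) * fvec Δ j  ≤⟨ *-mono-≤ C≤2^d (f≤F j j<m) ⟩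
      2 ^ d * F                       ∎
      where
      C≤2^d : (d ∸ j) C (d ∸ i) ≤ 2 ^ d
      C≤2^d = ≤-trans (nCk≤2^n (d ∸ j) (d ∸ i)) (^-monoʳ-≤ 2 (m∸n≤m d j))

  hvec-<-suc : ∀ {k} → k ≤ d → (∀ j → j ≤ k → fvec Δ j ≤ fvec Δ k) →
    suc (coefficientBound d + coefficientBound d) * fvec Δ k ≤ fvec Δ (suc k) →
    hvec Δ d k ℤ.< hvec Δ d (suc k)
  hvec-<-suc {k} k≤d f≤fₖ growth = begin-strict
    hvec Δ d k                 <⟨ <-+-dominant (hvec Δ d k) rest ∣hₖ∣≤X ∣rest∣≤X 2X<fₖ₊₁ ⟩
    rest ℤ.+ + fvec Δ (suc k)  ≡⟨ hvec-suc k ⟨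
    hvec Δ d (suc k)           ∎
    where
    open ℤ.≤-Reasoning
    W X : ℕ
    W = coefficientBound d
    X = W * fvec Δ k
    rest : ℤ
    rest = sumℤ (applyUpTo (hTerm (suc k)) (suc k))
    f<1+k≤fₖ : ∀ j → j < suc k → fvec Δ j ≤ fvec Δ k
    f<1+k≤fₖ j (s≤s j≤k) = f≤fₖ j j≤k
    ∣hₖ∣≤X : ∣ hvec Δ d k ∣ᶻ ≤ X
    ∣hₖ∣≤X rewrite hvec≡sumℤ-hTerm k = ∣sumℤ-hTerm∣≤ k (s≤s k≤d) f<1+k≤fₖ
    ∣rest∣≤X : ∣ rest ∣ᶻ ≤ X
    ∣rest∣≤X = ∣sumℤ-hTerm∣≤ (suc k) (s≤s k≤d) f<1+k≤fₖ
    2X<fₖ₊₁ : X + X < fvec Δ (suc k)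
    2X<fₖ₊₁ = w*m+w*m<n W (subst (_≤ fvec Δ k) (fvec-zero Δ) (f≤fₖ 0 z≤n)) growth

mainTheorem10 : (d i : ℕ) → i ≤ d →
    Σ ℕ (λ q → ∀ (n : ℕ) (Δ : SimplicialComplex n) → IsPure Δ d →
      (∀ (F : Subset n) → isFace Δ F ≡ true → ∣ F ∣ + 1 ≡ i → q ≤ linkVertexCount Δ F) →
      ∀ (k : ℕ) → k < i → hvec Δ d k ℤ.< hvec Δ d (suc k))
mainTheorem10 d i i≤d = suc d * g , hvec-increasing
  where
  g : ℕ
  g = suc (coefficientBound d + coefficientBound d)
  hvec-increasing : ∀ n (Δ : SimplicialComplex n) → IsPure Δ d →
    (∀ F → isFace Δ F ≡ true → ∣ F ∣ + 1 ≡ i → suc d * g ≤ linkVertexCount Δ F) →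
    ∀ k → k < i → hvec Δ d k ℤ.< hvec Δ d (suc k)
  hvec-increasing n Δ pure links k k<i = hvec-<-suc Δ d (≤-trans (<⇒≤ k<i) i≤d) fvec-monotone (growth k k<i)
    where
    growth : ∀ k → k < i → g * fvec Δ k ≤ fvec Δ (suc k)
    growth = fvec-growthRate Δ i≤d pure links
    fvec-step : ∀ k → k < i → fvec Δ k ≤ fvec Δ (suc k)
    fvec-step k k<i = ≤-trans (m≤n*m (fvec Δ k) g) (growth k k<i)
    fvec-monotone : ∀ j → j ≤ k → fvec Δ j ≤ fvec Δ k
    fvec-monotone j j≤k = monotone-upTo (fvec Δ) fvec-step j≤k (<⇒≤ k<i)
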